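{- Let $d\ge2$ and let $\boldsymbol\pi$ be a $d$-permutation that avoids the pattern $(21,12)$. If $\boldsymbol\pi$ contains an occurrence of the pattern $231$, then $\boldsymbol\pi$ is not admissible with respect to ${\bf C}_F$.
   Context: A $d$-permutation of size $n$ is a tuple $\boldsymbol{\pi}=(\pi_1,\ldots,\pi_{d-1})$ of permutations of $[n]$; put $\pi_0=\mathrm{id}$. Its points are $(i,\pi_1(i),\ldots,\pi_{d-1}(i))$, $i\in[n]$; $\pi_l(p)$ is the $l$-th coordinate of $p$. For distinct points $p,q$, ${\bf dir}(p,q)=(\mathrm{sign}(\pi_0(q)-\pi_0(p)),\ldots,\mathrm{sign}(\pi_{d-1}(q)-\pi_{d-1}(p)))$. $\mathbb{F}^d$ is the set of directions in $\{+1,-1\}^d$ with last entry $-1$. Max-tree $\gamma^d(\boldsymbol\pi)$: a rooted tree in which every node is a leaf or internal with $2^{d-1}$ children labelled by the directions of $\mathbb{F}^d$; empty $\boldsymbol\pi$ gives a leaf; otherwise the root corresponds to the point $p_{\max}$ with $\pi_{d-1}(p_{\max})=n$ and the child labelled ${\bf f}$ is the max-tree of the sub-$d$-permutation of points $p'$ with ${\bf dir}(p_{\max},p')={\bf f}$ (relabelled order-preservingly). Internal nodes correspond to points; $\mathcal{T}_{\bf f}(r)$ is the subtree at the child of $r$ labelled ${\bf f}$. $F=\{{\bf dir}^0,\ldots,{\bf dir}^{d-1}\}$ with ${\bf dir}^i=(+1$ repeated $i$ times, $-1$ repeated $d-i$ times$)$. ${\bf C}_F=(C,\ldots,C)$ ($d$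 copies) where $C$ orders $F$ by ${\bf dir}^i$ before ${\bf dir}^j$ iff $i<j$. $\boldsymbol\pi$ is admissible with respect to ${\bf C}_F$ if (i) for every internal node $r$ of $\gamma^d(\boldsymbol\pi)$, every $l\in\{0,\ldots,d-1\}$ and all $i<j$, every point of a node of $\mathcal{T}_{{\bf dir}^i}(r)$ has smaller $l$-th coordinate than every point of a node of $\mathcal{T}_{{\bf dir}^j}(r)$; and (ii) there are no internal nodes $r_1,r_2$ with $r_1\in\mathcal{T}_{\bf f}(r_2)$ for some ${\bf f}\in\mathbb{F}^d\setminus F$. Containment is via direct projections: $\boldsymbol\pi$ contains $(21,12)$ iff there are points $p,q$ and $0\le i<j<k\le d-1$ with $\pi_i(p)<\pi_i(q)$, $\pi_j(p)>\pi_j(q)$, $\pi_k(p)<\pi_k(q)$; it contains $231$ iff there are $0\le i<j\le d-1$ and points $a,b,c$ with $\pi_i(a)<\pi_i(b)<\pi_i(c)$ and $\pi_j(c)<\pi_j(a)<\pi_j(b)$. -}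

module Defs where

open import Data.Nat using (ℕ; zero; suc; pred; _≤_)
open import Data.Nat.Properties using ()
open import Data.Fin using (Fin; toℕ) renaming (zero to fzero; suc to fsuc)
import Data.Fin as F
import Data.Nat as N
open import Data.Fin.Permutation using (Permutation′; _⟨$⟩ʳ_)
open import Data.Bool using (Bool; true; false)
open import Data.Vec using (Vec; tabulate; lookup)
open import Data.Product using (Σ; ∃; ∃-syntax; _×_; _,_)
open import Relation.Nullary using (¬_)
open import Relation.Nullary.Decidable using (⌊_⌋)
open import Relation.Binary.PropositionalEquality using (_≡_; _≢_)

-- A d-permutation of size n: a tuple (π₁,…,π_{d-1}) of permutations of [n] (here [n] = Fin n).
-- (a record, so that d and n are inferable)
record DPerm (d n : ℕ) : Set where
  constructor dperm
  field perm : Fin (pred d) → Permutation′ n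
open DPerm public

-- Points are indexed by i ∈ Fin n (the point (i, π₁(i), …, π_{d-1}(i))).
-- coord π l p = π_l(p), with π₀ = id.
coord : ∀ {d n} → DPerm d n → Fin d → Fin n → Fin n
coord {suc k} π fzero    p = p
coord {suc k} π (fsuc l) p = perm π l ⟨$⟩ʳ p

IsLast : ∀ {d} → Fin d → Set
IsLast {d} l = suc (toℕ l) ≡ d

-- Directions in {+1,-1}^d, encoded as Vec Bool d with true = +1, false = -1.
Dir : ℕ → Set
Dir d = Vec Bool d

dir : ∀ {d n} → DPerm d n → Fin n → Fin n → Dir d
dir π p q = tabulate (λ l → ⌊ coord π l p F.<? coord π l q ⌋)

InFd : ∀ {d} → Dir d → Set
InFd {d} f = ∀ (l : Fin d) → IsLast l → lookup f l ≡ false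

dirF : ∀ {d} → Fin d → Dir d
dirF {d} i = tabulate (λ l → ⌊ toℕ l N.<? toℕ i ⌋)

InF : ∀ {d} → Dir d → Set
InF {d} f = ∃[ i ] (f ≡ dirF {d} i)

-- Sets of points (sub-d-permutations, before order-preserving relabelling,
-- which does not affect directions or relative order of coordinates).
PSet : ℕ → Set₁
PSet n = Fin n → Set

-- r is the point of S with maximal last coordinate (root of the max-tree of S)
IsMax : ∀ {d n} → DPerm d n → PSet n → Fin n → Set
IsMax {d} π S r = S r × (∀ q → S q → ∀ (l : Fin d) → IsLast l → coord π l q F.≤ coord π l r)

-- the point set of the subtree at the child labelled f of the node r
child : ∀ {d n} → DPerm d n → PSet n → Fin n → Dir d → PSet n
child π S r f q = S q × q ≢ r × dir π r q ≡ f

-- Node π S q : q is (the point of) an internal node of the max-tree of the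
-- sub-d-permutation on the point set S.
data Node {d n} (π : DPerm d n) : PSet n → Fin n → Set₁ where
  root  : ∀ {S r} → IsMax π S r → Node π S r
  below : ∀ {S r0 q} (g : Dir d) → IsMax π S r0 → Node π (child π S r0 g) q → Node π S q

-- InSub π S r f q : in the max-tree of the sub-d-permutation on S, r is an
-- internal node and q is (the point of) an internal node of 𝒯_f(r).
data InSub {d n} (π : DPerm d n) : PSet n → Fin n → Dir d → Fin n → Set₁ where
  here  : ∀ {S r f q} → IsMax π S r → Node π (child π S r f) q → InSub π S r f q
  there : ∀ {S r0 r f q} (g : Dir d) → IsMax π S r0 → InSub π (child π S r0 g) r f q → InSub π S r f q

allPts : ∀ {n} → PSet n
allPts _ = Data.Unit.⊤
  where import Data.Unit

InT : ∀ {d n} → DPerm d n → Fin n → Dir d → Fin n → Set₁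
InT π r f q = InSub π allPts r f q

Admissible : ∀ {d n} → DPerm d n → Set₁
Admissible {d} {n} π =
  (∀ (r : Fin n) (l i j : Fin d) → i F.< j → ∀ p q →
     InT π r (dirF i) p → InT π r (dirF j) q → coord π l p F.< coord π l q)
  × ¬ (∃[ r1 ] ∃[ r2 ] ∃[ f ] (InFd f × ¬ InF f × InT π r2 f r1))

Contains2112 : ∀ {d n} → DPerm d n → Set
Contains2112 {d} {n} π =
  ∃[ p ] ∃[ q ] ∃[ i ] ∃[ j ] ∃[ k ] (i F.< j × j F.< k ×
     coord π i p F.< coord π i q × coord π j q F.< coord π j p × coord π k p F.< coord π k q)

Contains231 : ∀ {d n} → DPerm d n → Set
Contains231 {d} {n} π =
  ∃[ i ] ∃[ j ] ∃[ a ] ∃[ b ] ∃[ c ] (i F.< j ×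
     coord π i a F.< coord π i b × coord π i b F.< coord π i c ×
     coord π j c F.< coord π j a × coord π j a F.< coord π j b)

{-# OPTIONS --safe #-}
-- Let a, b, c form a 231 (increasing in coordinate i, ordered c < a < b in coordinate j > i)
-- and descend γ(π) through subtrees containing all three. By admissibility every non-root
-- point of such a subtree lies in a child labelled dir^k, and when k < k′ every point of the
-- child dir^k lies below every point of the child dir^k′ in every coordinate. The root is none
-- of a, b, c: the signs of dir^k would force a cyclic chain of child indices. So all three lie
-- in a common child, and the descent goes on forever although heights strictly decrease.
module Submission where

open import Defs
open import Data.Nat using (ℕ; zero; suc; _≤_)
import Data.Nat as ℕ
import Data.Nat.Properties as ℕ
open import Data.Fin using (Fin; toℕ; fromℕ; _<_; _≟_; _<?_) renaming (zero to fzero; suc to fsuc)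
import Data.Fin as F
open import Data.Fin.Properties using (toℕ-injective; toℕ-fromℕ; toℕ<n; ≤-totalOrder; any?; ≤-antisym)
import Data.Bool as Bool
open import Data.Bool using (false)
open import Data.Vec using (lookup)
open import Data.Vec.Properties using (lookup∘tabulate; ≡-dec)
open import Data.List using (List; filter; allFin)
import Data.List.Relation.Unary.All as All
open import Data.List.Relation.Unary.All.Properties using (all-filter)
open import Data.List.Membership.Propositional.Properties using (∈-filter⁺; ∈-allFin)
import Data.List.Extrema
open import Data.Product using (∃; ∃-syntax; _×_; _,_; proj₁; proj₂)
open import Data.Empty using (⊥)
open import Data.Unit using (tt)
open import Function using (_∘_)
open import Function.Bundles using (Injection)
open import Function.Definitions using (Injective)
open import Function.Properties.Inverse using (↔⇒↣)
open import Relation.Nullary using (¬_; Dec; yes; no; does; contradiction)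
open import Relation.Nullary.Decidable using (⌊_⌋; dec-false; isYes≗does; _×-dec_; ¬?)
open import Relation.Unary using (Decidable; _⊆_)
open import Relation.Binary.PropositionalEquality using (_≡_; _≢_; refl; sym; trans; cong; subst; module ≡-Reasoning)

≤-≤-<-irrefl : ∀ {n} {x y z : Fin n} → x F.≤ y → y F.≤ z → z < x → ⊥
≤-≤-<-irrefl x≤y y≤z z<x = ℕ.<-irrefl refl (ℕ.≤-<-trans (ℕ.≤-trans x≤y y≤z) z<x)

⌊⌋-≡⇒ : ∀ {A B : Set} (a? : Dec A) (b? : Dec B) → ⌊ a? ⌋ ≡ ⌊ b? ⌋ → A → B
⌊⌋-≡⇒ (yes _) (yes b) _  _ = b
⌊⌋-≡⇒ (no ¬a) _       _  a = contradiction a ¬a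

coord-injective : ∀ {d n} (π : DPerm d n) l → Injective _≡_ _≡_ (coord π l)
coord-injective {suc d} π fzero    eq = eq
coord-injective {suc d} π (fsuc l) eq = Injection.injective (↔⇒↣ (perm π l)) eq

coord-<⇒≢ : ∀ {d n} (π : DPerm d n) l {x y} → coord π l x < coord π l y → x ≢ y
coord-<⇒≢ π l x<y refl = ℕ.<-irrefl refl x<y

module _ {d n} (π : DPerm d n) {p q : Fin n} {k : Fin d} (p→q : dir π p q ≡ dirF k) where

  dir≡dirF⇒agree : ∀ l → ⌊ coord π l p <? coord π l q ⌋ ≡ ⌊ toℕ l ℕ.<? toℕ k ⌋
  dir≡dirF⇒agree l = begin
    ⌊ coord π l p <? coord π l q ⌋  ≡⟨ sym (lookup∘tabulate _ l) ⟩
    lookup (dir π p q) l            ≡⟨ cong (λ v → lookup v l) p→q ⟩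
    lookup (dirF k) l               ≡⟨ lookup∘tabulate _ l ⟩
    ⌊ toℕ l ℕ.<? toℕ k ⌋            ∎
    where open ≡-Reasoning

  dir≡dirF⇒above⇒< : ∀ l → coord π l p < coord π l q → l < k
  dir≡dirF⇒above⇒< l = ⌊⌋-≡⇒ _ _ (dir≡dirF⇒agree l)

  dir≡dirF⇒below⇒≥ : ∀ l → coord π l q < coord π l p → k F.≤ l
  dir≡dirF⇒below⇒≥ l q<p =
    ℕ.≮⇒≥ (λ l<k → ℕ.<-asym q<p (⌊⌋-≡⇒ _ _ (sym (dir≡dirF⇒agree l)) l<k))

module MaxTree {d n} (π : DPerm (suc d) n) where

  height : Fin n → Fin n
  height = coord π (fromℕ d)

  isLast⇒≡fromℕ : ∀ {l : Fin (suc d)} → IsLast l → l ≡ fromℕ d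
  isLast⇒≡fromℕ last = toℕ-injective (trans (ℕ.suc-injective last) (sym (toℕ-fromℕ d)))

  IsMax-intro : ∀ {S m} → S m → (∀ x → S x → height x F.≤ height m) → IsMax π S m
  IsMax-intro m∈S bound = m∈S , λ x x∈S l last →
    subst (λ l → coord π l x F.≤ coord π l _) (sym (isLast⇒≡fromℕ last)) (bound x x∈S)

  IsMax⇒height-≤ : ∀ {S m x} → IsMax π S m → S x → height x F.≤ height m
  IsMax⇒height-≤ (_ , bound) x∈S = bound _ x∈S (fromℕ d) (cong suc (toℕ-fromℕ d))

  IsMax⇒height-< : ∀ {S m x} → IsMax π S m → S x → x ≢ m → height x < height m
  IsMax⇒height-< max x∈S x≢m =
    ℕ.≤∧≢⇒< (IsMax⇒height-≤ max x∈S) (x≢m ∘ coord-injective π (fromℕ d) ∘ toℕ-injective)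

  IsMax⇒dir∈𝔽 : ∀ {S m x} → IsMax π S m → S x → InFd (dir π m x)
  IsMax⇒dir∈𝔽 {m = m} {x} max x∈S l last rewrite isLast⇒≡fromℕ last = begin
    lookup (dir π m x) (fromℕ d)
      ≡⟨ lookup∘tabulate (λ l → ⌊ coord π l m <? coord π l x ⌋) (fromℕ d) ⟩
    ⌊ height m <? height x ⌋
      ≡⟨ isYes≗does (height m <? height x) ⟩
    does (height m <? height x)
      ≡⟨ dec-false (height m <? height x) (ℕ.≤⇒≯ (IsMax⇒height-≤ max x∈S)) ⟩
    false
      ∎
    where open ≡-Reasoning

  max-exists : ∀ {S} → Decidable S → ∀ {q} → S q → ∃ (IsMax π S)
  max-exists {S} S? {q} q∈S = argmax height q candidates , IsMax-intro m∈S bound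
    where
      open Data.List.Extrema (≤-totalOrder n)
      candidates : List (Fin n)
      candidates = filter S? (allFin n)
      m∈S : S (argmax height q candidates)
      m∈S = argmax-all height q∈S (all-filter S? (allFin n))
      bound : ∀ x → S x → height x F.≤ height (argmax height q candidates)
      bound x x∈S = All.lookup (f[xs]≤f[argmax] q candidates) (∈-filter⁺ S? (∈-allFin x) x∈S)

  Bounded : PSet n → ℕ → Set
  Bounded S B = ∀ {x} → S x → toℕ (height x) ℕ.< B

  child? : ∀ {S} → Decidable S → ∀ m f → Decidable (child π S m f)
  child? S? m f x = S? x ×-dec ¬? (x ≟ m) ×-dec ≡-dec Bool._≟_ (dir π m x) f

  child-bounded : ∀ {S m B} → IsMax π S m → Bounded S (suc B) → ∀ f → Bounded (child π S m f) B
  child-bounded max bounded f (x∈S , x≢m , _) =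
    ℕ.<-≤-trans (IsMax⇒height-< max x∈S x≢m) (ℕ.≤-pred (bounded (proj₁ max)))

  ⊆Node : ∀ B {S} → Decidable S → Bounded S B → S ⊆ Node π S
  ⊆Node zero    S? bounded q∈S = contradiction (bounded q∈S) ℕ.n≮0
  ⊆Node (suc B) S? bounded {q} q∈S with max-exists S? q∈S
  ... | m , max with q ≟ m
  ...   | yes refl = root max
  ...   | no q≢m = below (dir π m q) max
          (⊆Node B (child? S? m _) (child-bounded max bounded _) (q∈S , q≢m , refl))

  -- Point sets met while descending γ(π) from its root; B bounds heights to drive recursion.
  record Subtree (B : ℕ) : Set₁ where
    field
      points   : PSet n
      points?  : Decidable points
      bounded  : Bounded points B
      embedded : ∀ {r f q} → InSub π points r f q → InT π r f q
  open Subtree public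

  whole : Subtree n
  whole = record
    { points   = allPts
    ; points?  = λ _ → yes tt
    ; bounded  = λ {x} _ → toℕ<n (height x)
    ; embedded = λ t → t
    }

  childSubtree : ∀ {B} (T : Subtree (suc B)) {m} → IsMax π (points T) m → Dir (suc d) → Subtree B
  childSubtree T {m} max f = record
    { points   = child π (points T) m f
    ; points?  = child? (points? T) m f
    ; bounded  = child-bounded max (bounded T) f
    ; embedded = embedded T ∘ there f max
    }

  InT-dir : ∀ {B} (T : Subtree B) {m x} → IsMax π (points T) m → points T x → x ≢ m →
            InT π m (dir π m x) x
  InT-dir {B} T max x∈T x≢m = embedded T (here max
    (⊆Node B (child? (points? T) _ _) (λ x∈ → bounded T (proj₁ x∈)) (x∈T , x≢m , refl)))

module _ {d n} {π : DPerm (suc d) n} (adm : Admissible π) where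
  open MaxTree π

  InFChild : Fin n → Fin n → Set₁
  InFChild m x = ∃[ k ] (dir π m x ≡ dirF k × InT π m (dirF k) x)

  IsMax⇒InFChild : ∀ {B} (T : Subtree B) {m x} → IsMax π (points T) m → points T x → x ≢ m →
                   InFChild m x
  IsMax⇒InFChild T {m} {x} max x∈T x≢m with any? (λ k → ≡-dec Bool._≟_ (dir π m x) (dirF k))
  ... | yes (k , m→x) = k , m→x , subst (λ f → InT π m f x) m→x (InT-dir T max x∈T x≢m)
  ... | no  dir∉F     =
    contradiction (x , m , dir π m x , IsMax⇒dir∈𝔽 max x∈T , dir∉F , InT-dir T max x∈T x≢m) (proj₂ adm)

  index-≤ : ∀ {m k k′ x y} → InT π m (dirF k) x → InT π m (dirF k′) y →
            ∀ l → coord π l x < coord π l y → k F.≤ k′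
  index-≤ {m} {k} {k′} x∈k y∈k′ l x<y =
    ℕ.≮⇒≥ (λ k′<k → ℕ.<-asym x<y (proj₁ adm m l k′ k k′<k _ _ y∈k′ x∈k))

  module _ {i j : Fin (suc d)} {a b c : Fin n} (i<j : i < j)
           (a<ᵢb : coord π i a < coord π i b) (b<ᵢc : coord π i b < coord π i c)
           (c<ⱼa : coord π j c < coord π j a) (a<ⱼb : coord π j a < coord π j b) where

    a<ᵢc : coord π i a < coord π i c
    a<ᵢc = ℕ.<-trans a<ᵢb b<ᵢc

    c<ⱼb : coord π j c < coord π j b
    c<ⱼb = ℕ.<-trans c<ⱼa a<ⱼb

    ¬IsMax-a : ∀ {B} (T : Subtree B) → IsMax π (points T) a → points T b → points T c → ⊥
    ¬IsMax-a T max b∈T c∈T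
      with IsMax⇒InFChild T max b∈T (coord-<⇒≢ π i a<ᵢb ∘ sym)
         | IsMax⇒InFChild T max c∈T (coord-<⇒≢ π i a<ᵢc ∘ sym)
    ... | kb , a→b , b∈kb | kc , a→c , c∈kc =
      ≤-≤-<-irrefl (index-≤ b∈kb c∈kc i b<ᵢc)
                   (dir≡dirF⇒below⇒≥ π a→c j c<ⱼa)
                   (dir≡dirF⇒above⇒< π a→b j a<ⱼb)

    ¬IsMax-b : ∀ {B} (T : Subtree B) → IsMax π (points T) b → points T a → points T c → ⊥
    ¬IsMax-b T max a∈T c∈T
      with IsMax⇒InFChild T max a∈T (coord-<⇒≢ π i a<ᵢb)
         | IsMax⇒InFChild T max c∈T (coord-<⇒≢ π i b<ᵢc ∘ sym)
    ... | ka , b→a , a∈ka | kc , b→c , c∈kc =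
      ≤-≤-<-irrefl (index-≤ c∈kc a∈ka j c<ⱼa)
                   (dir≡dirF⇒below⇒≥ π b→a i a<ᵢb)
                   (dir≡dirF⇒above⇒< π b→c i b<ᵢc)

    ¬IsMax-c : ∀ {B} (T : Subtree B) → IsMax π (points T) c → points T a → ⊥
    ¬IsMax-c T max a∈T with IsMax⇒InFChild T max a∈T (coord-<⇒≢ π i a<ᵢc)
    ... | ka , c→a , _ =
      ≤-≤-<-irrefl (dir≡dirF⇒below⇒≥ π c→a i a<ᵢc)
                   (ℕ.<⇒≤ i<j)
                   (dir≡dirF⇒above⇒< π c→a j c<ⱼa)

    common-child : ∀ {B} (T : Subtree B) {m} → IsMax π (points T) m →
                   points T a → points T b → points T c → a ≢ m → b ≢ m → c ≢ m →
                   ∃[ f ] (child π (points T) m f a × child π (points T) m f b × child π (points T) m f c)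
    common-child T max a∈T b∈T c∈T a≢m b≢m c≢m
      with IsMax⇒InFChild T max a∈T a≢m
         | IsMax⇒InFChild T max b∈T b≢m
         | IsMax⇒InFChild T max c∈T c≢m
    ... | ka , m→a , a∈ka | kb , m→b , b∈kb | kc , m→c , c∈kc =
      dirF kc , (a∈T , a≢m , trans m→a (cong dirF ka≡kc))
              , (b∈T , b≢m , trans m→b (cong dirF kb≡kc))
              , (c∈T , c≢m , m→c)
      where
        ka≡kc : ka ≡ kc
        ka≡kc = ≤-antisym (index-≤ a∈ka c∈kc i a<ᵢc) (index-≤ c∈kc a∈ka j c<ⱼa)
        kb≡kc : kb ≡ kc
        kb≡kc = ≤-antisym (index-≤ b∈kb c∈kc i b<ᵢc) (index-≤ c∈kc b∈kb j c<ⱼb)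

    no-subtree-contains-abc : ∀ {B} (T : Subtree B) → points T a → points T b → points T c → ⊥
    no-subtree-contains-abc {zero}  T a∈T _ _ = ℕ.n≮0 (bounded T a∈T)
    no-subtree-contains-abc {suc B} T a∈T b∈T c∈T with max-exists (points? T) a∈T
    ... | m , max with a ≟ m | b ≟ m | c ≟ m
    ... | yes refl | _        | _        = ¬IsMax-a T max b∈T c∈T
    ... | no _     | yes refl | _        = ¬IsMax-b T max a∈T c∈T
    ... | no _     | no _     | yes refl = ¬IsMax-c T max a∈T
    ... | no a≢m   | no b≢m   | no c≢m
      with common-child T max a∈T b∈T c∈T a≢m b≢m c≢m
    ... | f , a∈f , b∈f , c∈f = no-subtree-contains-abc (childSubtree T max f) a∈f b∈f c∈f

contains231⇒¬admissible : ∀ {d n} (π : DPerm d n) → Contains231 π → ¬ Admissible π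
contains231⇒¬admissible {suc d} π (i , j , a , b , c , i<j , a<ᵢb , b<ᵢc , c<ⱼa , a<ⱼb) adm =
  no-subtree-contains-abc adm i<j a<ᵢb b<ᵢc c<ⱼa a<ⱼb (MaxTree.whole π) tt tt tt

proposition3 : (d : ℕ) → 2 ≤ d → ∀ {n} (π : DPerm d n) →
    ¬ Contains2112 π → Contains231 π → ¬ Admissible π
proposition3 d _ π _ = contains231⇒¬admissible π
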